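{- Let $k\ge 2$ and let $Q_n=Q_n^{(k)}:=L_{ -n}^{(k)}$ for $n\in\mathbb{Z}$. Then: (i) $Q_{mk+r}=0$ for all integers $0\le m<r\le k-2$; (ii) $Q_{mk-1}=-2^{m-1}$ for all integers $m\in[1,k-2]$; (iii) $Q_{mk+r}=(-1)^r\left[\psi(m-1,r-1)2^{m-r}+\psi(m-1,r)2^{m-r-2}\right]$ for all integers $0\le r\le m\le k-2$ with $m\ge 1$; (iv) for all integers $r\in[-1,k-2]$ and $m\ge \max\{1,k-2\}$, $$Q_{mk+r}=\sum_{i=0}^{l}(-1)^{ik+r}\left[\psi(m-i-1,ik+r-1)\,2^{m-i(k+1)-r}+\psi(m-i-1,ik+r)\,2^{m-i(k+1)-r-2}\right],$$ where $l=m$ if $k=2$ and $l=\lfloor (m+1)/(k-1)\rfloor$ if $k>2$.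
   Context: For an integer $k\ge 2$, the $k$-generalized Lucas sequence is defined by $L_0^{(k)}=2$, $L_1^{(k)}=1$, $L_n^{(k)}=0$ for $-(k-2)\le n\le -1$, and $L_n^{(k)}=\sum_{j=1}^{k}L_{n-j}^{(k)}$ for $n\ge 2$, extended to all negative indices by $L_{n-k}^{(k)}=L_n^{(k)}-L_{n-1}^{(k)}-\cdots-L_{n-(k-1)}^{(k)}$ for all integers $n$. (Equivalently, $Q_0=2$, $Q_i=0$ for $1\le i\le k-2$, $Q_{k-1}=-1$, and $Q_n=Q_{n-k}-Q_{n-(k-1)}-\cdots-Q_{n-1}$ for $n\ge k$.) For integers $a,b$ with $a\ge -1$, the binomial coefficient $\binom{a}{b}$ equals $\frac{a!}{b!(a-b)!}$ if $0\le b\le a$ and $0$ otherwise. Define $\psi(y,z)=\binom{y}{z}+\binom{y+1}{z+1}$; in particular $\psi(y,-1)=1$ and $\psi(y,z)=0$ whenever $z>y$. -}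

module Defs where

open import Data.Nat as ℕ using (ℕ; zero; suc)
open import Data.Nat.Combinatorics using (_C_)
open import Data.Integer as ℤ using (ℤ; +_; -[1+_])
open import Data.Rational as ℚ using (ℚ)
open import Data.List using (List; []; _∷_; _++_; replicate)

sumℤ : List ℤ → ℤ
sumℤ []       = ℤ.0ℤ
sumℤ (x ∷ xs) = x ℤ.+ sumℤ xs

headOr0 : List ℤ → ℤ
headOr0 []      = ℤ.0ℤ
headOr0 (x ∷ _) = x

-- The window at step n is
--   (L_{n-(k-2)}, L_{n-(k-3)}, …, L_{n+1})   (length k),
-- starting from (0,…,0,2,1) = (L_{-(k-2)},…,L_{-1},L_0,L_1),
-- and shifted by the recurrence L_n = L_{n-1}+…+L_{n-k}.
fwdStep : List ℤ → List ℤ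
fwdStep []       = []
fwdStep (x ∷ xs) = xs ++ ((x ℤ.+ sumℤ xs) ∷ [])

fwdWin : ℕ → ℕ → List ℤ
fwdWin k zero    = replicate (k ℕ.∸ 2) ℤ.0ℤ ++ (+ 2 ∷ + 1 ∷ [])
fwdWin k (suc n) = fwdStep (fwdWin k n)

-- Lfwd k n = L^{(k)}_{n-(k-2)}
Lfwd : ℕ → ℕ → ℤ
Lfwd k n = headOr0 (fwdWin k n)

-- Backward direction, via Q_n = L_{-n} for n ≥ 0.  The window at step n
-- is (Q_n, …, Q_{n+k-1}), starting from (2,0,…,0,-1), shifted by
-- Q_{n+k} = Q_n - Q_{n+1} - … - Q_{n+k-1}, i.e. by
-- L_{n-k} = L_n - L_{n-1} - … - L_{n-(k-1)}.
bwdStep : List ℤ → List ℤ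
bwdStep []       = []
bwdStep (x ∷ xs) = xs ++ ((x ℤ.- sumℤ xs) ∷ [])

bwdWin : ℕ → ℕ → List ℤ
bwdWin k zero    = + 2 ∷ (replicate (k ℕ.∸ 2) ℤ.0ℤ ++ (ℤ.-1ℤ ∷ []))
bwdWin k (suc n) = bwdStep (bwdWin k n)

-- Qnat k n = L^{(k)}_{-n}  for n ≥ 0
Qnat : ℕ → ℕ → ℤ
Qnat k n = headOr0 (bwdWin k n)

-- L k n = L^{(k)}_n for every integer n (intended for k ≥ 2).
L : ℕ → ℤ → ℤ
L k (+ n)      = Lfwd k (n ℕ.+ (k ℕ.∸ 2))
L k -[1+ n ]   = Qnat k (suc n)

Q : ℕ → ℤ → ℤ
Q k n = L k (ℤ.- n)

binom : ℤ → ℤ → ℕ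
binom (+ a)    (+ b)    = a C b      -- stdlib: a C b = 0 when b > a
binom (+ a)    -[1+ b ] = 0
binom -[1+ a ] _        = 0

toℚ : ℤ → ℚ
toℚ z = z ℚ./ 1

ψ : ℤ → ℤ → ℚ
ψ y z = toℚ (+ (binom y z ℕ.+ binom (y ℤ.+ ℤ.1ℤ) (z ℤ.+ ℤ.1ℤ)))

qpow : ℚ → ℕ → ℚ
qpow q zero    = ℚ.1ℚ
qpow q (suc n) = q ℚ.* qpow q n

pow2 : ℤ → ℚ
pow2 (+ n)      = qpow (toℚ (+ 2)) n
pow2 -[1+ n ]   = qpow (+ 1 ℚ./ 2) (suc n)

sgn : ℤ → ℚ
sgn z = qpow (toℚ ℤ.-1ℤ) ℤ.∣ z ∣

sumTo : ℕ → (ℕ → ℚ) → ℚ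
sumTo zero    f = f 0
sumTo (suc l) f = sumTo l f ℚ.+ f (suc l)

-- upper summation limit: l = m if k = 2, l = ⌊(m+1)/(k-1)⌋ if k > 2
lBound : ℕ → ℕ → ℕ
lBound (suc (suc zero))    m = m
lBound (suc (suc (suc j))) m = suc m ℕ./ suc (suc j)
lBound _                   m = 0

{-# OPTIONS --safe #-}
module Submission where

-- Subtracting the backward recurrence at n from the one at n + 1 gives the three-term
-- recurrence Q_{n+k+1} = 2 Q_{n+1} - Q_n, i.e. Q_{(m+1)k+r+1} = 2 Q_{mk+r+1} - Q_{mk+r}.
-- The summands φ(j, t) = (-1)^t [ψ(j-1, t-1) 2^{j-t} + ψ(j-1, t) 2^{j-t-2}] obey the same rule,
-- φ(j+1, t+1) = 2 φ(j, t+1) - φ(j, t), inherited from Pascal's rule for binomials.  So by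
-- induction on m, starting from Q_0 = 2, Q_1 = … = Q_{k-2} = 0, Q_{k-1} = -1, one gets
-- Q_{mk+r} = Σ_{i=0}^{m} φ(m-i, ik+r) for every m ≥ 1 and -1 ≤ r ≤ k-2; passing from r = k-2
-- to r = -1 of the next block shifts i by one.  Since φ(j, t) = 0 for t > j, the summands with
-- i(k+1) + r > m vanish.  Dropping them gives (iv); when m ≤ k-2 only i = 0 can survive,
-- which gives (ii) and (iii), and for r > m nothing survives, which gives (i).

open import Defs
open import Data.Nat as ℕ using (ℕ; zero; suc; _≤_; _<_; z≤n; s≤s)
import Data.Nat.Properties as ℕP
import Data.Nat.Tactic.RingSolver as ℕ-Solver
open import Data.Nat.Combinatorics using (_C_; k>n⇒nCk≡0; nCk+nC[k+1]≡[n+1]C[k+1])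
open import Data.Nat.DivMod using (m/n<m; m*n/n≡m; /-monoˡ-≤)
open import Data.Integer as ℤ using (ℤ; +_; -[1+_]; 0ℤ; 1ℤ; -1ℤ; NonNegative)
import Data.Integer.Properties as ℤP
open import Data.Integer.Tactic.RingSolver using (solve-∀)
open import Data.Rational as ℚ using (ℚ; mkℚ; 0ℚ)
import Data.Rational.Properties as ℚP
open import Data.Rational.Solver using (module +-*-Solver)
import Data.Nat.Coprimality as Coprimality
open import Data.List using (List; []; _∷_; _++_; replicate; length)
open import Data.List.Properties using (length-++; length-replicate)
open import Data.Product using (_,_; _×_)
open import Data.Sum as Sum using (_⊎_; inj₁; inj₂)
open import Relation.Binary.PropositionalEquality
open import Relation.Nullary using (contradiction)
open ≡-Reasoning

nth : List ℤ → ℕ → ℤ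
nth []       _       = 0ℤ
nth (x ∷ xs) zero    = x
nth (x ∷ xs) (suc i) = nth xs i

nth-zero : ∀ l → nth l 0 ≡ headOr0 l
nth-zero []      = refl
nth-zero (x ∷ l) = refl

nth-++ˡ : ∀ xs ys {i} → i < length xs → nth (xs ++ ys) i ≡ nth xs i
nth-++ˡ (x ∷ xs) ys {zero}  _         = refl
nth-++ˡ (x ∷ xs) ys {suc i} (s≤s i<n) = nth-++ˡ xs ys i<n

nth-++-length : ∀ xs y ys → nth (xs ++ y ∷ ys) (length xs) ≡ y
nth-++-length []       y ys = refl
nth-++-length (x ∷ xs) y ys = nth-++-length xs y ys

nth-replicate-0 : ∀ n {i} → i < n → nth (replicate n 0ℤ) i ≡ 0ℤ
nth-replicate-0 (suc n) {zero}  _         = refl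
nth-replicate-0 (suc n) {suc i} (s≤s i<n) = nth-replicate-0 n i<n

sumℤ-++ : ∀ xs ys → sumℤ (xs ++ ys) ≡ sumℤ xs ℤ.+ sumℤ ys
sumℤ-++ []       ys = sym (ℤP.+-identityˡ _)
sumℤ-++ (x ∷ xs) ys = trans (cong (λ s → x ℤ.+ s) (sumℤ-++ xs ys)) (sym (ℤP.+-assoc x _ _))

sumℤ-replicate-0 : ∀ n → sumℤ (replicate n 0ℤ) ≡ 0ℤ
sumℤ-replicate-0 zero    = refl
sumℤ-replicate-0 (suc n) = trans (ℤP.+-identityˡ _) (sumℤ-replicate-0 n)

length-bwdStep : ∀ l → length (bwdStep l) ≡ length l
length-bwdStep []       = refl
length-bwdStep (x ∷ xs) = trans (length-++ xs) (ℕP.+-comm (length xs) 1)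

nth-bwdStep : ∀ l {i} → suc i < length l → nth (bwdStep l) i ≡ nth l (suc i)
nth-bwdStep (x ∷ xs) (s≤s i<n) = nth-++ˡ xs _ i<n

nth-bwdStep-last : ∀ l {n} → length l ≡ suc n →
                   nth (bwdStep l) n ≡ headOr0 l ℤ.- (sumℤ l ℤ.- headOr0 l)
nth-bwdStep-last (x ∷ xs) refl = begin
  nth (xs ++ x ℤ.- sumℤ xs ∷ []) (length xs)  ≡⟨ nth-++-length xs _ [] ⟩
  x ℤ.- sumℤ xs                              ≡⟨ cong (λ s → x ℤ.- s) (cancel x (sumℤ xs)) ⟩
  x ℤ.- (x ℤ.+ sumℤ xs ℤ.- x)                ∎
  where
  cancel : ∀ x s → s ≡ x ℤ.+ s ℤ.- x
  cancel = solve-∀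

sumℤ-bwdStep : ∀ l → sumℤ (bwdStep l) ≡ headOr0 l
sumℤ-bwdStep []       = refl
sumℤ-bwdStep (x ∷ xs) = trans (sumℤ-++ xs _) (cancel (sumℤ xs) x)
  where
  cancel : ∀ s x → s ℤ.+ ((x ℤ.- s) ℤ.+ 0ℤ) ≡ x
  cancel = solve-∀

module BackwardRecurrence (j : ℕ) where

  k : ℕ
  k = suc (suc j)

  length-bwdWin : ∀ n → length (bwdWin k n) ≡ k
  length-bwdWin zero    = cong suc (trans (length-++ (replicate j 0ℤ))
                            (trans (cong (ℕ._+ 1) (length-replicate j)) (ℕP.+-comm j 1)))
  length-bwdWin (suc n) = trans (length-bwdStep (bwdWin k n)) (length-bwdWin n)

  nth-bwdWin : ∀ n {i} → i < k → nth (bwdWin k n) i ≡ Qnat k (n ℕ.+ i)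
  nth-bwdWin n {zero}  _   = trans (nth-zero (bwdWin k n)) (cong (Qnat k) (sym (ℕP.+-identityʳ n)))
  nth-bwdWin n {suc i} i<k = begin
    nth (bwdWin k n) (suc i)         ≡⟨ nth-bwdStep (bwdWin k n) (subst (suc i <_) (sym (length-bwdWin n)) i<k) ⟨
    nth (bwdWin k (suc n)) i         ≡⟨ nth-bwdWin (suc n) (ℕP.<-trans (ℕP.n<1+n i) i<k) ⟩
    Qnat k (suc n ℕ.+ i)             ≡⟨ cong (Qnat k) (ℕP.+-suc n i) ⟨
    Qnat k (n ℕ.+ suc i)             ∎

  Qnat[n+k] : ∀ n → Qnat k (n ℕ.+ k) ≡ Qnat k n ℤ.- (sumℤ (bwdWin k n) ℤ.- Qnat k n)
  Qnat[n+k] n = begin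
    Qnat k (n ℕ.+ k)                 ≡⟨ cong (Qnat k) (ℕP.+-suc n (suc j)) ⟩
    Qnat k (suc n ℕ.+ suc j)         ≡⟨ nth-bwdWin (suc n) ℕP.≤-refl ⟨
    nth (bwdWin k (suc n)) (suc j)   ≡⟨ nth-bwdStep-last (bwdWin k n) (length-bwdWin n) ⟩
    Qnat k n ℤ.- (sumℤ (bwdWin k n) ℤ.- Qnat k n) ∎

  Qnat-rec : ∀ n → Qnat k (suc n ℕ.+ k) ≡ (Qnat k (suc n) ℤ.+ Qnat k (suc n)) ℤ.- Qnat k n
  Qnat-rec n = begin
    Qnat k (suc n ℕ.+ k)                                   ≡⟨ Qnat[n+k] (suc n) ⟩
    Qnat k (suc n) ℤ.- (sumℤ (bwdWin k (suc n)) ℤ.- Qnat k (suc n))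
      ≡⟨ cong (λ s → Qnat k (suc n) ℤ.- (s ℤ.- Qnat k (suc n))) (sumℤ-bwdStep (bwdWin k n)) ⟩
    Qnat k (suc n) ℤ.- (Qnat k n ℤ.- Qnat k (suc n))       ≡⟨ rearrange (Qnat k (suc n)) (Qnat k n) ⟩
    (Qnat k (suc n) ℤ.+ Qnat k (suc n)) ℤ.- Qnat k n       ∎
    where
    rearrange : ∀ a b → a ℤ.- (b ℤ.- a) ≡ (a ℤ.+ a) ℤ.- b
    rearrange = solve-∀

  Qnat[1+i]≡0 : ∀ {i} → i < j → Qnat k (suc i) ≡ 0ℤ
  Qnat[1+i]≡0 {i} i<j = begin
    Qnat k (suc i)                                 ≡⟨ nth-bwdWin 0 (s≤s (ℕP.m<n⇒m<1+n i<j)) ⟨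
    nth (replicate j 0ℤ ++ -1ℤ ∷ []) i             ≡⟨ nth-++ˡ (replicate j 0ℤ) _ (subst (i <_) (sym (length-replicate j)) i<j) ⟩
    nth (replicate j 0ℤ) i                         ≡⟨ nth-replicate-0 j i<j ⟩
    0ℤ                                             ∎

  Qnat[k-1]≡-1 : Qnat k (suc j) ≡ -1ℤ
  Qnat[k-1]≡-1 = begin
    Qnat k (suc j)                                 ≡⟨ nth-bwdWin 0 ℕP.≤-refl ⟨
    nth (replicate j 0ℤ ++ -1ℤ ∷ []) j             ≡⟨ cong (nth (replicate j 0ℤ ++ -1ℤ ∷ [])) (length-replicate j) ⟨
    nth (replicate j 0ℤ ++ -1ℤ ∷ []) (length (replicate j 0ℤ)) ≡⟨ nth-++-length (replicate j 0ℤ) _ [] ⟩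
    -1ℤ                                            ∎

  Qnat[k]≡3 : Qnat k k ≡ + 3
  Qnat[k]≡3 = trans (Qnat[n+k] 0) (cong (λ s → + 2 ℤ.- (s ℤ.- + 2)) initial-sum)
    where
    initial-sum : sumℤ (bwdWin k 0) ≡ + 1
    initial-sum = cong (λ s → + 2 ℤ.+ s)
      (trans (sumℤ-++ (replicate j 0ℤ) _) (cong (ℤ._+ -1ℤ) (sumℤ-replicate-0 j)))

toℚ≡mkℚ : ∀ z → toℚ z ≡ mkℚ z 0 (Coprimality.sym (Coprimality.1-coprimeTo _))
toℚ≡mkℚ z = ℚP.↥p/↧p≡p _

toℚ-+ : ∀ a b → toℚ (a ℤ.+ b) ≡ toℚ a ℚ.+ toℚ b
toℚ-+ a b = sym (begin
  toℚ a ℚ.+ toℚ b                      ≡⟨ cong₂ ℚ._+_ (toℚ≡mkℚ a) (toℚ≡mkℚ b) ⟩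
  (a ℤ.* + 1 ℤ.+ b ℤ.* + 1) ℚ./ 1      ≡⟨ cong₂ (λ x y → (x ℤ.+ y) ℚ./ 1) (ℤP.*-identityʳ a) (ℤP.*-identityʳ b) ⟩
  toℚ (a ℤ.+ b)                        ∎)

toℚ-* : ∀ a b → toℚ (a ℤ.* b) ≡ toℚ a ℚ.* toℚ b
toℚ-* a b = sym (cong₂ ℚ._*_ (toℚ≡mkℚ a) (toℚ≡mkℚ b))

toℚ-neg : ∀ a → toℚ (ℤ.- a) ≡ ℚ.- toℚ a
toℚ-neg a = trans (toℚ≡mkℚ (ℤ.- a)) (trans (mkℚ-neg a) (cong ℚ.-_ (sym (toℚ≡mkℚ a))))
  where
  mkℚ-neg : ∀ a → mkℚ (ℤ.- a) 0 (Coprimality.sym (Coprimality.1-coprimeTo _)) ≡ ℚ.- mkℚ a 0 (Coprimality.sym (Coprimality.1-coprimeTo _))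
  mkℚ-neg (+ zero)  = refl
  mkℚ-neg (+ suc n) = refl
  mkℚ-neg -[1+ n ]  = refl

toℚ-sub : ∀ a b → toℚ (a ℤ.- b) ≡ toℚ a ℚ.- toℚ b
toℚ-sub a b = trans (toℚ-+ a (ℤ.- b)) (cong (toℚ a ℚ.+_) (toℚ-neg b))

toℚ-injective : ∀ {a b} → toℚ a ≡ toℚ b → a ≡ b
toℚ-injective {a} {b} eq = begin
  a                              ≡⟨ cong ℚ.numerator (toℚ≡mkℚ a) ⟨
  ℚ.numerator (toℚ a)            ≡⟨ cong ℚ.numerator eq ⟩
  ℚ.numerator (toℚ b)            ≡⟨ cong ℚ.numerator (toℚ≡mkℚ b) ⟩
  b                              ∎

two : ℚ
two = toℚ (+ 2)

pow2-suc : ∀ z → pow2 (z ℤ.+ 1ℤ) ≡ two ℚ.* pow2 z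
pow2-suc (+ n)         = cong (qpow two) (ℕP.+-comm n 1)
pow2-suc -[1+ zero ]   = refl
pow2-suc -[1+ suc n ]  = halve (qpow (+ 1 ℚ./ 2) (suc n))
  where
  open +-*-Solver
  halve : ∀ x → x ≡ two ℚ.* ((+ 1 ℚ./ 2) ℚ.* x)
  halve = solve 1 (λ x → x := con two :* (con (+ 1 ℚ./ 2) :* x)) refl

pow2-of-suc : ∀ {a} b → a ≡ b ℤ.+ 1ℤ → pow2 a ≡ two ℚ.* pow2 b
pow2-of-suc b refl = pow2-suc b

pow2-pos : ∀ n → pow2 (+ n) ≡ toℚ (+ (2 ℕ.^ n))
pow2-pos zero    = refl
pow2-pos (suc n) = begin
  two ℚ.* pow2 (+ n)                  ≡⟨ cong (two ℚ.*_) (pow2-pos n) ⟩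
  two ℚ.* toℚ (+ (2 ℕ.^ n))           ≡⟨ toℚ-* (+ 2) (+ (2 ℕ.^ n)) ⟨
  toℚ (+ 2 ℤ.* + (2 ℕ.^ n))           ≡⟨ cong toℚ (ℤP.pos-* 2 (2 ℕ.^ n)) ⟨
  toℚ (+ (2 ℕ.^ suc n))               ∎

sgn-suc : ∀ z → sgn (z ℤ.+ 1ℤ) ≡ ℚ.- sgn z
sgn-suc (+ n)         = trans (cong (qpow (toℚ -1ℤ)) (ℕP.+-comm n 1)) (negate (sgn (+ n)))
  where
  open +-*-Solver
  negate : ∀ x → toℚ -1ℤ ℚ.* x ≡ ℚ.- x
  negate = solve 1 (λ x → con (toℚ -1ℤ) :* x := :- x) refl
sgn-suc -[1+ zero ]   = refl
sgn-suc -[1+ suc n ]  = negate² (sgn -[1+ n ])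
  where
  open +-*-Solver
  negate² : ∀ x → x ≡ ℚ.- (toℚ -1ℤ ℚ.* x)
  negate² = solve 1 (λ x → x := :- (con (toℚ -1ℤ) :* x)) refl

pos-suc : ∀ n → + suc n ≡ + n ℤ.+ 1ℤ
pos-suc n = cong +_ (ℕP.+-comm 1 n)

z+1-1≡z : ∀ z → z ℤ.+ 1ℤ ℤ.- 1ℤ ≡ z
z+1-1≡z = solve-∀

z-1+1≡z : ∀ z → z ℤ.- 1ℤ ℤ.+ 1ℤ ≡ z
z-1+1≡z = solve-∀

pos-suc-+-pred : ∀ n s → + suc n ℤ.+ (+ s ℤ.- 1ℤ) ≡ + (n ℕ.+ s)
pos-suc-+-pred n s = trans (cong (ℤ._+ (+ s ℤ.- 1ℤ)) (pos-suc n)) (cancel (+ n) (+ s))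
  where
  cancel : ∀ a b → a ℤ.+ 1ℤ ℤ.+ (b ℤ.- 1ℤ) ≡ a ℤ.+ b
  cancel = solve-∀

nonNegative-suc : ∀ {y} → NonNegative y → NonNegative (y ℤ.+ 1ℤ)
nonNegative-suc {+ n} _ = _

binom-neg-lower : ∀ y b → binom y -[1+ b ] ≡ 0
binom-neg-lower (+ a)    b = refl
binom-neg-lower -[1+ a ] b = refl

binom-above : ∀ y d → binom y (y ℤ.+ + suc d) ≡ 0
binom-above (+ a)    d = k>n⇒nCk≡0 (ℕP.m<m+n a (s≤s z≤n))
binom-above -[1+ a ] d = refl

-- Pascal's rule fails only at y = z = -1, where binom 0 0 = 1.
binom-pascal : ∀ y z → NonNegative y ⊎ NonNegative z →
               binom (y ℤ.+ 1ℤ) (z ℤ.+ 1ℤ) ≡ binom y (z ℤ.+ 1ℤ) ℕ.+ binom y z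
binom-pascal (+ a) (+ b) _ = begin
  (a ℕ.+ 1) C (b ℕ.+ 1)          ≡⟨ cong₂ _C_ (ℕP.+-comm a 1) (ℕP.+-comm b 1) ⟩
  suc a C suc b                  ≡⟨ nCk+nC[k+1]≡[n+1]C[k+1] a b ⟨
  a C b ℕ.+ a C suc b            ≡⟨ ℕP.+-comm (a C b) _ ⟩
  a C suc b ℕ.+ a C b            ≡⟨ cong (λ c → a C c ℕ.+ a C b) (ℕP.+-comm 1 b) ⟩
  a C (b ℕ.+ 1) ℕ.+ a C b        ∎
binom-pascal (+ a)          -[1+ zero ]    _ = cong (λ n → n C 0) (ℕP.+-comm a 1)
binom-pascal (+ a)          -[1+ suc b ]   _ = refl
binom-pascal -[1+ zero ]    (+ b)          _ = k>n⇒nCk≡0 (subst (0 <_) (ℕP.+-comm 1 b) (s≤s z≤n))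
binom-pascal -[1+ suc a ]   (+ b)          _ = refl
binom-pascal -[1+ zero ]    -[1+ b ]       (inj₁ ())
binom-pascal -[1+ zero ]    -[1+ b ]       (inj₂ ())
binom-pascal -[1+ suc a ]   -[1+ b ]       _ = refl

ψ-pascal : ∀ y z → NonNegative y ⊎ NonNegative z → ψ (y ℤ.+ 1ℤ) (z ℤ.+ 1ℤ) ≡ ψ y (z ℤ.+ 1ℤ) ℚ.+ ψ y z
ψ-pascal y z h = begin
  toℚ (+ (binom y′ z′ ℕ.+ binom (y′ ℤ.+ 1ℤ) (z′ ℤ.+ 1ℤ)))
    ≡⟨ cong (λ n → toℚ (+ n)) (cong₂ ℕ._+_ (binom-pascal y z h)
                                 (binom-pascal y′ z′ (Sum.map nonNegative-suc nonNegative-suc h))) ⟩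
  toℚ (+ ((binom y z′ ℕ.+ binom y z) ℕ.+ (binom y′ (z′ ℤ.+ 1ℤ) ℕ.+ binom y′ z′)))
    ≡⟨ cong (λ n → toℚ (+ n)) (interchange (binom y z′) _ _ _) ⟩
  toℚ (+ (binom y z′ ℕ.+ binom y′ (z′ ℤ.+ 1ℤ)) ℤ.+ + (binom y z ℕ.+ binom y′ z′))
    ≡⟨ toℚ-+ (+ (binom y z′ ℕ.+ binom y′ (z′ ℤ.+ 1ℤ))) (+ (binom y z ℕ.+ binom y′ z′)) ⟩
  ψ y z′ ℚ.+ ψ y z
    ∎
  where
  y′ = y ℤ.+ 1ℤ
  z′ = z ℤ.+ 1ℤ
  interchange : ∀ a b c d → (a ℕ.+ b) ℕ.+ (c ℕ.+ d) ≡ (a ℕ.+ c) ℕ.+ (b ℕ.+ d)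
  interchange = ℕ-Solver.solve-∀

ψ-below-minus-one : ∀ y b → ψ y -[1+ suc b ] ≡ 0ℚ
ψ-below-minus-one y b = cong (λ n → toℚ (+ n)) (cong₂ ℕ._+_ (binom-neg-lower y (suc b)) (binom-neg-lower (y ℤ.+ 1ℤ) b))

ψ-above : ∀ y d → ψ y (y ℤ.+ + suc d) ≡ 0ℚ
ψ-above y d = cong (λ n → toℚ (+ n)) (cong₂ ℕ._+_ (binom-above y d)
  (trans (cong (binom (y ℤ.+ 1ℤ)) (shift y (+ suc d))) (binom-above (y ℤ.+ 1ℤ) d)))
  where
  shift : ∀ y s → y ℤ.+ s ℤ.+ 1ℤ ≡ y ℤ.+ 1ℤ ℤ.+ s
  shift = solve-∀

-- φ (m - i) (ik + r) is the i-th summand of (iv), and φ m r the right-hand side of (iii).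
φ : ℤ → ℤ → ℚ
φ j t = sgn t ℚ.* (ψ (j ℤ.- 1ℤ) (t ℤ.- 1ℤ) ℚ.* pow2 (j ℤ.- t) ℚ.+ ψ (j ℤ.- 1ℤ) t ℚ.* pow2 (j ℤ.- t ℤ.- + 2))

φ-vanish : ∀ j t → ψ (j ℤ.- 1ℤ) (t ℤ.- 1ℤ) ≡ 0ℚ → ψ (j ℤ.- 1ℤ) t ≡ 0ℚ → φ j t ≡ 0ℚ
φ-vanish j t ψ₁≡0 ψ₂≡0 = begin
  sgn t ℚ.* (ψ (j ℤ.- 1ℤ) (t ℤ.- 1ℤ) ℚ.* pow2 (j ℤ.- t) ℚ.+ ψ (j ℤ.- 1ℤ) t ℚ.* pow2 (j ℤ.- t ℤ.- + 2))
    ≡⟨ cong₂ (λ a b → sgn t ℚ.* (a ℚ.* pow2 (j ℤ.- t) ℚ.+ b ℚ.* pow2 (j ℤ.- t ℤ.- + 2))) ψ₁≡0 ψ₂≡0 ⟩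
  sgn t ℚ.* (0ℚ ℚ.* pow2 (j ℤ.- t) ℚ.+ 0ℚ ℚ.* pow2 (j ℤ.- t ℤ.- + 2))
    ≡⟨ annihilate (sgn t) (pow2 (j ℤ.- t)) (pow2 (j ℤ.- t ℤ.- + 2)) ⟩
  0ℚ ∎
  where
  open +-*-Solver
  annihilate : ∀ s a b → s ℚ.* (0ℚ ℚ.* a ℚ.+ 0ℚ ℚ.* b) ≡ 0ℚ
  annihilate = solve 3 (λ s a b → s :* (con 0ℚ :* a :+ con 0ℚ :* b) := con 0ℚ) refl

φ-of-negative : ∀ c t → φ -[1+ c ] t ≡ 0ℚ
φ-of-negative c t = φ-vanish -[1+ c ] t refl refl

φ-below-minus-one : ∀ j n → φ j -[1+ suc n ] ≡ 0ℚ
φ-below-minus-one j n = φ-vanish j -[1+ suc n ] (ψ-below-minus-one (j ℤ.- 1ℤ) _) (ψ-below-minus-one (j ℤ.- 1ℤ) n)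

φ-above : ∀ j d → φ j (j ℤ.+ + suc d) ≡ 0ℚ
φ-above j d = φ-vanish j (j ℤ.+ + suc d)
  (trans (cong (ψ (j ℤ.- 1ℤ)) (shift₁ j (+ suc d))) (ψ-above (j ℤ.- 1ℤ) d))
  (trans (cong (ψ (j ℤ.- 1ℤ)) (trans (shift₂ j (+ suc d)) (cong (λ s → j ℤ.- 1ℤ ℤ.+ s) (sym (pos-suc (suc d))))))
         (ψ-above (j ℤ.- 1ℤ) (suc d)))
  where
  shift₁ : ∀ j s → j ℤ.+ s ℤ.- 1ℤ ≡ j ℤ.- 1ℤ ℤ.+ s
  shift₁ = solve-∀
  shift₂ : ∀ j s → j ℤ.+ s ≡ j ℤ.- 1ℤ ℤ.+ (s ℤ.+ 1ℤ)
  shift₂ = solve-∀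

φ-pascal : ∀ j t → NonNegative (j ℤ.- 1ℤ) ⊎ NonNegative (t ℤ.- 1ℤ) →
           φ (j ℤ.+ 1ℤ) (t ℤ.+ 1ℤ) ≡ two ℚ.* φ j (t ℤ.+ 1ℤ) ℚ.- φ j t
φ-pascal j t h = begin
  φ (j ℤ.+ 1ℤ) (t ℤ.+ 1ℤ)
    ≡⟨ cong₂ ℚ._*_ (sgn-suc t) (cong₂ ℚ._+_ (cong₂ ℚ._*_ ψ-lower pow2-lower) (cong₂ ℚ._*_ ψ-upper pow2-upper)) ⟩
  (ℚ.- s) ℚ.* ((b ℚ.+ a) ℚ.* (two ℚ.* p) ℚ.+ (c ℚ.+ b) ℚ.* (two ℚ.* q))
    ≡⟨ regroup s a b c p q ⟩
  two ℚ.* ((ℚ.- s) ℚ.* (b ℚ.* p ℚ.+ c ℚ.* q)) ℚ.- s ℚ.* (a ℚ.* (two ℚ.* p) ℚ.+ b ℚ.* (two ℚ.* q))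
    ≡⟨ cong₂ (λ u v → two ℚ.* u ℚ.- v) φ-at-t+1 φ-at-t ⟨
  two ℚ.* φ j (t ℤ.+ 1ℤ) ℚ.- φ j t
    ∎
  where
  y = j ℤ.- 1ℤ
  s = sgn t
  a = ψ y (t ℤ.- 1ℤ)
  b = ψ y t
  c = ψ y (t ℤ.+ 1ℤ)
  e = j ℤ.- (t ℤ.+ 1ℤ)
  p = pow2 e
  q = pow2 (e ℤ.- + 2)

  lower-exponent : ∀ j t → j ℤ.- t ≡ j ℤ.- (t ℤ.+ 1ℤ) ℤ.+ 1ℤ
  lower-exponent = solve-∀
  upper-exponent : ∀ j t → j ℤ.- t ℤ.- + 2 ≡ j ℤ.- (t ℤ.+ 1ℤ) ℤ.- + 2 ℤ.+ 1ℤ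
  upper-exponent = solve-∀
  shift-both : ∀ j t → j ℤ.+ 1ℤ ℤ.- (t ℤ.+ 1ℤ) ≡ j ℤ.- t
  shift-both = solve-∀

  h-upper : NonNegative y ⊎ NonNegative t
  h-upper = Sum.map (λ y≥0 → y≥0) (λ t-1≥0 → subst NonNegative (z-1+1≡z t) (nonNegative-suc t-1≥0)) h

  ψ-lower : ψ (j ℤ.+ 1ℤ ℤ.- 1ℤ) (t ℤ.+ 1ℤ ℤ.- 1ℤ) ≡ b ℚ.+ a
  ψ-lower = begin
    ψ (j ℤ.+ 1ℤ ℤ.- 1ℤ) (t ℤ.+ 1ℤ ℤ.- 1ℤ)   ≡⟨ cong₂ ψ (trans (z+1-1≡z j) (sym (z-1+1≡z j))) (trans (z+1-1≡z t) (sym (z-1+1≡z t))) ⟩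
    ψ (y ℤ.+ 1ℤ) (t ℤ.- 1ℤ ℤ.+ 1ℤ)          ≡⟨ ψ-pascal y (t ℤ.- 1ℤ) h ⟩
    ψ y (t ℤ.- 1ℤ ℤ.+ 1ℤ) ℚ.+ a            ≡⟨ cong (λ u → ψ y u ℚ.+ a) (z-1+1≡z t) ⟩
    b ℚ.+ a                                ∎

  ψ-upper : ψ (j ℤ.+ 1ℤ ℤ.- 1ℤ) (t ℤ.+ 1ℤ) ≡ c ℚ.+ b
  ψ-upper = trans (cong (λ x → ψ x (t ℤ.+ 1ℤ)) (trans (z+1-1≡z j) (sym (z-1+1≡z j)))) (ψ-pascal y t h-upper)

  pow2-lower : pow2 (j ℤ.+ 1ℤ ℤ.- (t ℤ.+ 1ℤ)) ≡ two ℚ.* p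
  pow2-lower = pow2-of-suc e (trans (shift-both j t) (lower-exponent j t))

  pow2-upper : pow2 (j ℤ.+ 1ℤ ℤ.- (t ℤ.+ 1ℤ) ℤ.- + 2) ≡ two ℚ.* q
  pow2-upper = pow2-of-suc (e ℤ.- + 2) (trans (cong (ℤ._- + 2) (shift-both j t)) (upper-exponent j t))

  φ-at-t+1 : φ j (t ℤ.+ 1ℤ) ≡ (ℚ.- s) ℚ.* (b ℚ.* p ℚ.+ c ℚ.* q)
  φ-at-t+1 = cong₂ (λ σ u → σ ℚ.* (ψ y u ℚ.* p ℚ.+ c ℚ.* q)) (sgn-suc t) (z+1-1≡z t)

  φ-at-t : φ j t ≡ s ℚ.* (a ℚ.* (two ℚ.* p) ℚ.+ b ℚ.* (two ℚ.* q))
  φ-at-t = cong₂ (λ p r → s ℚ.* (a ℚ.* p ℚ.+ b ℚ.* r))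
             (pow2-of-suc e (lower-exponent j t)) (pow2-of-suc (e ℤ.- + 2) (upper-exponent j t))

  regroup : ∀ s a b c p q →
    (ℚ.- s) ℚ.* ((b ℚ.+ a) ℚ.* (two ℚ.* p) ℚ.+ (c ℚ.+ b) ℚ.* (two ℚ.* q))
      ≡ two ℚ.* ((ℚ.- s) ℚ.* (b ℚ.* p ℚ.+ c ℚ.* q)) ℚ.- s ℚ.* (a ℚ.* (two ℚ.* p) ℚ.+ b ℚ.* (two ℚ.* q))
  regroup = solve 6 (λ s a b c p q →
    (:- s) :* ((b :+ a) :* (con two :* p) :+ (c :+ b) :* (con two :* q))
      := con two :* ((:- s) :* (b :* p :+ c :* q)) :- s :* (a :* (con two :* p) :+ b :* (con two :* q))) refl
    where open +-*-Solver

φ-above-ℕ : ∀ m i c s → suc m < c ℕ.+ i ℕ.+ s → φ (+ m ℤ.- + i) (+ c ℤ.+ (+ s ℤ.- 1ℤ)) ≡ 0ℚ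
φ-above-ℕ m i c s m+2≤c+i+s with ℕP.m≤n⇒∃[o]m+o≡n m+2≤c+i+s
... | e , m+2+e≡c+i+s = trans (cong (φ (+ m ℤ.- + i)) column) (φ-above (+ m ℤ.- + i) e)
  where
  split : ∀ c i s → c ℤ.+ (s ℤ.- 1ℤ) ≡ c ℤ.+ i ℤ.+ s ℤ.- i ℤ.- 1ℤ
  split = solve-∀
  merge : ∀ m e i → m ℤ.+ e ℤ.+ 1ℤ ℤ.+ 1ℤ ℤ.- i ℤ.- 1ℤ ≡ m ℤ.- i ℤ.+ (e ℤ.+ 1ℤ)
  merge = solve-∀
  column : + c ℤ.+ (+ s ℤ.- 1ℤ) ≡ + m ℤ.- + i ℤ.+ + suc e
  column = begin
    + c ℤ.+ (+ s ℤ.- 1ℤ)                          ≡⟨ split (+ c) (+ i) (+ s) ⟩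
    + (c ℕ.+ i ℕ.+ s) ℤ.- + i ℤ.- 1ℤ              ≡⟨ cong (λ n → + n ℤ.- + i ℤ.- 1ℤ) (sym m+2+e≡c+i+s) ⟩
    + suc (suc (m ℕ.+ e)) ℤ.- + i ℤ.- 1ℤ          ≡⟨ cong (λ n → n ℤ.- + i ℤ.- 1ℤ) (trans (pos-suc (suc (m ℕ.+ e))) (cong (ℤ._+ 1ℤ) (pos-suc (m ℕ.+ e)))) ⟩
    + m ℤ.+ + e ℤ.+ 1ℤ ℤ.+ 1ℤ ℤ.- + i ℤ.- 1ℤ      ≡⟨ merge (+ m) (+ e) (+ i) ⟩
    + m ℤ.- + i ℤ.+ (+ e ℤ.+ 1ℤ)                  ≡⟨ cong (λ x → + m ℤ.- + i ℤ.+ x) (pos-suc e) ⟨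
    + m ℤ.- + i ℤ.+ + suc e                       ∎

φ-at-minus-one : ∀ n → φ (+ suc n) -1ℤ ≡ toℚ (ℤ.- + (2 ℕ.^ n))
φ-at-minus-one n = begin
  φ (+ suc n) -1ℤ
    ≡⟨ cong (λ e → sgn -1ℤ ℚ.* (toℚ (+ 0) ℚ.* pow2 (+ suc n ℤ.- -1ℤ) ℚ.+ toℚ (+ 1) ℚ.* pow2 e))
             (trans (cong (λ a → a ℤ.- -1ℤ ℤ.- + 2) (pos-suc n)) (exponent (+ n))) ⟩
  sgn -1ℤ ℚ.* (toℚ (+ 0) ℚ.* pow2 (+ suc n ℤ.- -1ℤ) ℚ.+ toℚ (+ 1) ℚ.* pow2 (+ n))
    ≡⟨ simplify (pow2 (+ suc n ℤ.- -1ℤ)) (pow2 (+ n)) ⟩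
  ℚ.- pow2 (+ n)
    ≡⟨ cong ℚ.-_ (pow2-pos n) ⟩
  ℚ.- toℚ (+ (2 ℕ.^ n))
    ≡⟨ toℚ-neg (+ (2 ℕ.^ n)) ⟨
  toℚ (ℤ.- + (2 ℕ.^ n))
    ∎
  where
  exponent : ∀ a → a ℤ.+ 1ℤ ℤ.- -1ℤ ℤ.- + 2 ≡ a
  exponent = solve-∀
  open +-*-Solver
  simplify : ∀ x y → sgn -1ℤ ℚ.* (toℚ (+ 0) ℚ.* x ℚ.+ toℚ (+ 1) ℚ.* y) ≡ ℚ.- y
  simplify = solve 2 (λ x y → con (sgn -1ℤ) :* (con (toℚ (+ 0)) :* x :+ con (toℚ (+ 1)) :* y) := :- y) refl

sumTo-cong : ∀ B {f g} → (∀ i → i ≤ B → f i ≡ g i) → sumTo B f ≡ sumTo B g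
sumTo-cong zero    f≡g = f≡g 0 z≤n
sumTo-cong (suc B) f≡g = cong₂ ℚ._+_ (sumTo-cong B (λ i i≤B → f≡g i (ℕP.m≤n⇒m≤1+n i≤B))) (f≡g (suc B) ℕP.≤-refl)

sumTo-linear : ∀ B c f g → sumTo B (λ i → c ℚ.* f i ℚ.- g i) ≡ c ℚ.* sumTo B f ℚ.- sumTo B g
sumTo-linear zero    c f g = refl
sumTo-linear (suc B) c f g = begin
  sumTo B (λ i → c ℚ.* f i ℚ.- g i) ℚ.+ (c ℚ.* f (suc B) ℚ.- g (suc B))
    ≡⟨ cong (ℚ._+ (c ℚ.* f (suc B) ℚ.- g (suc B))) (sumTo-linear B c f g) ⟩
  (c ℚ.* sumTo B f ℚ.- sumTo B g) ℚ.+ (c ℚ.* f (suc B) ℚ.- g (suc B))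
    ≡⟨ distribute c (sumTo B f) (sumTo B g) (f (suc B)) (g (suc B)) ⟩
  c ℚ.* (sumTo B f ℚ.+ f (suc B)) ℚ.- (sumTo B g ℚ.+ g (suc B))
    ∎
  where
  open +-*-Solver
  distribute : ∀ c x y u v → (c ℚ.* x ℚ.- y) ℚ.+ (c ℚ.* u ℚ.- v) ≡ c ℚ.* (x ℚ.+ u) ℚ.- (y ℚ.+ v)
  distribute = solve 5 (λ c x y u v → (c :* x :- y) :+ (c :* u :- v) := c :* (x :+ u) :- (y :+ v)) refl

sumTo-suc-head : ∀ B f → sumTo (suc B) f ≡ f 0 ℚ.+ sumTo B (λ i → f (suc i))
sumTo-suc-head zero    f = refl
sumTo-suc-head (suc B) f = trans (cong (ℚ._+ f (suc (suc B))) (sumTo-suc-head B f)) (ℚP.+-assoc (f 0) _ _)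

sumTo-truncate : ∀ {l} B f → l ≤ B → (∀ i → l < i → i ≤ B → f i ≡ 0ℚ) → sumTo B f ≡ sumTo l f
sumTo-truncate B f l≤B vanish with ℕP.m≤n⇒m<n∨m≡n l≤B
... | inj₂ refl = refl
sumTo-truncate {l} (suc B) f _ vanish | inj₁ (s≤s l≤B) = begin
  sumTo B f ℚ.+ f (suc B)    ≡⟨ cong (sumTo B f ℚ.+_) (vanish (suc B) (s≤s l≤B) ℕP.≤-refl) ⟩
  sumTo B f ℚ.+ 0ℚ           ≡⟨ ℚP.+-identityʳ (sumTo B f) ⟩
  sumTo B f                  ≡⟨ sumTo-truncate B f l≤B (λ i l<i i≤B → vanish i l<i (ℕP.m≤n⇒m≤1+n i≤B)) ⟩
  sumTo l f                  ∎

module LucasSum (j : ℕ) where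
  open BackwardRecurrence j

  q : ℕ → ℚ
  q n = toℚ (Qnat k n)

  q-rec : ∀ n → q (suc n ℕ.+ k) ≡ two ℚ.* q (suc n) ℚ.- q n
  q-rec n = begin
    toℚ (Qnat k (suc n ℕ.+ k))                           ≡⟨ cong toℚ (Qnat-rec n) ⟩
    toℚ ((Qnat k (suc n) ℤ.+ Qnat k (suc n)) ℤ.- Qnat k n) ≡⟨ toℚ-sub (Qnat k (suc n) ℤ.+ Qnat k (suc n)) (Qnat k n) ⟩
    toℚ (Qnat k (suc n) ℤ.+ Qnat k (suc n)) ℚ.- q n      ≡⟨ cong (ℚ._- q n) (toℚ-+ (Qnat k (suc n)) (Qnat k (suc n))) ⟩
    (q (suc n) ℚ.+ q (suc n)) ℚ.- q n                    ≡⟨ double (q (suc n)) (q n) ⟩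
    two ℚ.* q (suc n) ℚ.- q n                            ∎
    where
    open +-*-Solver
    double : ∀ a b → (a ℚ.+ a) ℚ.- b ≡ two ℚ.* a ℚ.- b
    double = solve 2 (λ a b → (a :+ a) :- b := con two :* a :- b) refl

  summand : ℕ → ℤ → ℕ → ℚ
  summand m r i = φ (+ m ℤ.- + i) (+ (i ℕ.* k) ℤ.+ r)

  lucasSum : ℕ → ℤ → ℚ
  lucasSum m r = sumTo m (summand m r)

  lucasSum-pascal : ∀ m r →
    (∀ i → i ≤ suc m → NonNegative (+ m ℤ.- + i ℤ.- 1ℤ) ⊎ NonNegative (+ (i ℕ.* k) ℤ.+ r ℤ.- 1ℤ)) →
    lucasSum (suc m) (r ℤ.+ 1ℤ) ≡ two ℚ.* lucasSum m (r ℤ.+ 1ℤ) ℚ.- lucasSum m r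
  lucasSum-pascal m r pascal-applies = begin
    sumTo (suc m) (summand (suc m) (r ℤ.+ 1ℤ))
      ≡⟨ sumTo-cong (suc m) summand-pascal ⟩
    sumTo (suc m) (λ i → two ℚ.* summand m (r ℤ.+ 1ℤ) i ℚ.- summand m r i)
      ≡⟨ sumTo-linear (suc m) two (summand m (r ℤ.+ 1ℤ)) (summand m r) ⟩
    two ℚ.* sumTo (suc m) (summand m (r ℤ.+ 1ℤ)) ℚ.- sumTo (suc m) (summand m r)
      ≡⟨ cong₂ (λ u v → two ℚ.* u ℚ.- v) (drop-last (r ℤ.+ 1ℤ)) (drop-last r) ⟩
    two ℚ.* lucasSum m (r ℤ.+ 1ℤ) ℚ.- lucasSum m r
      ∎
    where
    suc-minus : ∀ a b → a ℤ.+ 1ℤ ℤ.- b ≡ a ℤ.- b ℤ.+ 1ℤ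
    suc-minus = solve-∀
    minus-suc : ∀ a → a ℤ.- (a ℤ.+ 1ℤ) ≡ -1ℤ
    minus-suc = solve-∀

    summand-pascal : ∀ i → i ≤ suc m → summand (suc m) (r ℤ.+ 1ℤ) i ≡ two ℚ.* summand m (r ℤ.+ 1ℤ) i ℚ.- summand m r i
    summand-pascal i i≤1+m = begin
      φ (+ suc m ℤ.- + i) (+ (i ℕ.* k) ℤ.+ (r ℤ.+ 1ℤ))
        ≡⟨ cong₂ φ (trans (cong (ℤ._- + i) (pos-suc m)) (suc-minus (+ m) (+ i))) (sym (ℤP.+-assoc (+ (i ℕ.* k)) r 1ℤ)) ⟩
      φ (+ m ℤ.- + i ℤ.+ 1ℤ) (+ (i ℕ.* k) ℤ.+ r ℤ.+ 1ℤ)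
        ≡⟨ φ-pascal (+ m ℤ.- + i) (+ (i ℕ.* k) ℤ.+ r) (pascal-applies i i≤1+m) ⟩
      two ℚ.* φ (+ m ℤ.- + i) (+ (i ℕ.* k) ℤ.+ r ℤ.+ 1ℤ) ℚ.- summand m r i
        ≡⟨ cong (λ t → two ℚ.* φ (+ m ℤ.- + i) t ℚ.- summand m r i) (ℤP.+-assoc (+ (i ℕ.* k)) r 1ℤ) ⟩
      two ℚ.* summand m (r ℤ.+ 1ℤ) i ℚ.- summand m r i
        ∎

    drop-last : ∀ r → sumTo (suc m) (summand m r) ≡ lucasSum m r
    drop-last r = begin
      lucasSum m r ℚ.+ φ (+ m ℤ.- + suc m) (+ (suc m ℕ.* k) ℤ.+ r)
        ≡⟨ cong (λ x → lucasSum m r ℚ.+ φ x (+ (suc m ℕ.* k) ℤ.+ r)) (trans (cong (λ x → + m ℤ.- x) (pos-suc m)) (minus-suc (+ m))) ⟩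
      lucasSum m r ℚ.+ φ -1ℤ (+ (suc m ℕ.* k) ℤ.+ r)
        ≡⟨ cong (lucasSum m r ℚ.+_) (φ-of-negative 0 (+ (suc m ℕ.* k) ℤ.+ r)) ⟩
      lucasSum m r ℚ.+ 0ℚ
        ≡⟨ ℚP.+-identityʳ (lucasSum m r) ⟩
      lucasSum m r
        ∎

  lucasSum-step : ∀ m s →
    lucasSum (suc (suc m)) (+ s) ≡ two ℚ.* lucasSum (suc m) (+ s) ℚ.- lucasSum (suc m) (+ s ℤ.- 1ℤ)
  lucasSum-step m s =
    subst (λ r → lucasSum (suc (suc m)) r ≡ two ℚ.* lucasSum (suc m) r ℚ.- lucasSum (suc m) (+ s ℤ.- 1ℤ))
          (z-1+1≡z (+ s)) (lucasSum-pascal (suc m) (+ s ℤ.- 1ℤ) pascal-applies)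
    where
    pascal-applies : ∀ i → i ≤ suc (suc m) →
      NonNegative (+ suc m ℤ.- + i ℤ.- 1ℤ) ⊎ NonNegative (+ (i ℕ.* k) ℤ.+ (+ s ℤ.- 1ℤ) ℤ.- 1ℤ)
    pascal-applies zero    _ = inj₁ _
    pascal-applies (suc i) _ = inj₂ (subst NonNegative (sym (cong (ℤ._- 1ℤ) (pos-suc-+-pred (suc (j ℕ.+ i ℕ.* k)) s))) _)

  -- Pascal's rule at r = -2; the shift i ↦ i + 1 then turns lucasSum (m + 2) (-2) into lucasSum (m + 1) (k - 2).
  lucasSum-wrap : ∀ m → lucasSum (suc (suc (suc m))) -1ℤ ≡ two ℚ.* lucasSum (suc (suc m)) -1ℤ ℚ.- lucasSum (suc m) (+ j)
  lucasSum-wrap m = begin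
    lucasSum (suc (suc (suc m))) -1ℤ
      ≡⟨ lucasSum-pascal (suc (suc m)) -[1+ 1 ] pascal-applies ⟩
    two ℚ.* lucasSum (suc (suc m)) -1ℤ ℚ.- lucasSum (suc (suc m)) -[1+ 1 ]
      ≡⟨ cong (λ x → two ℚ.* lucasSum (suc (suc m)) -1ℤ ℚ.- x) reindex ⟩
    two ℚ.* lucasSum (suc (suc m)) -1ℤ ℚ.- lucasSum (suc m) (+ j)
      ∎
    where
    pascal-applies : ∀ i → i ≤ suc (suc (suc m)) →
      NonNegative (+ suc (suc m) ℤ.- + i ℤ.- 1ℤ) ⊎ NonNegative (+ (i ℕ.* k) ℤ.+ -[1+ 1 ] ℤ.- 1ℤ)
    pascal-applies zero          _ = inj₁ _
    pascal-applies (suc zero)    _ = inj₁ _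
    pascal-applies (suc (suc i)) _ =
      inj₂ (subst NonNegative (cong (λ n → + n ℤ.- 1ℤ) (sym (ℕP.+-suc j (suc (j ℕ.+ i ℕ.* k))))) _)

    suc-minus-suc : ∀ a b → a ℤ.+ 1ℤ ℤ.- (b ℤ.+ 1ℤ) ≡ a ℤ.- b
    suc-minus-suc = solve-∀

    reindex : lucasSum (suc (suc m)) -[1+ 1 ] ≡ lucasSum (suc m) (+ j)
    reindex = begin
      lucasSum (suc (suc m)) -[1+ 1 ]
        ≡⟨ sumTo-suc-head (suc m) (summand (suc (suc m)) -[1+ 1 ]) ⟩
      summand (suc (suc m)) -[1+ 1 ] 0 ℚ.+ sumTo (suc m) (λ i → summand (suc (suc m)) -[1+ 1 ] (suc i))
        ≡⟨ cong (ℚ._+ sumTo (suc m) (λ i → summand (suc (suc m)) -[1+ 1 ] (suc i))) (φ-below-minus-one (+ suc (suc m) ℤ.- + 0) 0) ⟩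
      0ℚ ℚ.+ sumTo (suc m) (λ i → summand (suc (suc m)) -[1+ 1 ] (suc i))
        ≡⟨ ℚP.+-identityˡ _ ⟩
      sumTo (suc m) (λ i → summand (suc (suc m)) -[1+ 1 ] (suc i))
        ≡⟨ sumTo-cong (suc m) (λ i _ → cong₂ φ (degree i) (cong +_ (ℕP.+-comm j (i ℕ.* k)))) ⟩
      lucasSum (suc m) (+ j)
        ∎
      where
      degree : ∀ i → + suc (suc m) ℤ.- + suc i ≡ + suc m ℤ.- + i
      degree i = trans (cong₂ ℤ._-_ (pos-suc (suc m)) (pos-suc i)) (suc-minus-suc (+ suc m) (+ i))

  lucasSum-one : ∀ s → lucasSum 1 (+ s ℤ.- 1ℤ) ≡ φ (+ 1) (+ s ℤ.- 1ℤ)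
  lucasSum-one s = begin
    φ (+ 1) (+ 0 ℤ.+ (+ s ℤ.- 1ℤ)) ℚ.+ φ (+ 0) (+ (k ℕ.+ 0) ℤ.+ (+ s ℤ.- 1ℤ))
      ≡⟨ cong₂ ℚ._+_ (cong (φ (+ 1)) (ℤP.+-identityˡ (+ s ℤ.- 1ℤ)))
                     (trans (cong (φ (+ 0)) (pos-suc-+-pred (suc (j ℕ.+ 0)) s)) (φ-above (+ 0) (j ℕ.+ 0 ℕ.+ s))) ⟩
    φ (+ 1) (+ s ℤ.- 1ℤ) ℚ.+ 0ℚ
      ≡⟨ ℚP.+-identityʳ _ ⟩
    φ (+ 1) (+ s ℤ.- 1ℤ)
      ∎

  q[k+s-1]≡φ[1,s-1] : ∀ s → s ≤ suc j → q (suc j ℕ.+ s) ≡ φ (+ 1) (+ s ℤ.- 1ℤ)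
  q[k+s-1]≡φ[1,s-1] zero          _         = trans (cong q (ℕP.+-identityʳ (suc j))) (cong toℚ Qnat[k-1]≡-1)
  q[k+s-1]≡φ[1,s-1] (suc zero)    _         = trans (cong q (ℕP.+-comm (suc j) 1)) (cong toℚ Qnat[k]≡3)
  q[k+s-1]≡φ[1,s-1] (suc (suc s)) (s≤s s<j) = begin
    q (suc j ℕ.+ suc (suc s))   ≡⟨ cong q (index j s) ⟩
    q (suc s ℕ.+ k)             ≡⟨ q-rec s ⟩
    two ℚ.* q (suc s) ℚ.- q s   ≡⟨ initial s s<j ⟩
    φ (+ 1) (+ suc s)           ∎
    where
    index : ∀ j s → suc j ℕ.+ suc (suc s) ≡ suc s ℕ.+ suc (suc j)
    index = ℕ-Solver.solve-∀
    initial : ∀ s → s < j → two ℚ.* q (suc s) ℚ.- q s ≡ φ (+ 1) (+ suc s)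
    initial zero    0<j       = cong (λ x → two ℚ.* x ℚ.- q 0) (cong toℚ (Qnat[1+i]≡0 0<j))
    initial (suc s) (s≤s s<j) = trans (cong₂ (λ x y → two ℚ.* x ℚ.- y) (cong toℚ (Qnat[1+i]≡0 (s≤s s<j)))
                                                                      (cong toℚ (Qnat[1+i]≡0 (ℕP.m<n⇒m<1+n s<j))))
                                      (sym (φ-above (+ 1) s))

-- The second base case of q≡lucasSum below: the step into r = -1 reaches back two blocks.
q[2k-1]≡lucasSum[2,-1] : ∀ j → LucasSum.q j (suc j ℕ.+ 1 ℕ.* suc (suc j) ℕ.+ 0) ≡ LucasSum.lucasSum j 2 -1ℤ
q[2k-1]≡lucasSum[2,-1] zero    = refl
q[2k-1]≡lucasSum[2,-1] (suc j) = begin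
  q (suc j′ ℕ.+ 1 ℕ.* k ℕ.+ 0)   ≡⟨ cong q (trans (ℕP.+-identityʳ _) (cong (suc j′ ℕ.+_) (ℕP.*-identityˡ k))) ⟩
  q (suc j′ ℕ.+ k)               ≡⟨ q-rec j′ ⟩
  two ℚ.* q (suc j′) ℚ.- q j′    ≡⟨ cong₂ (λ x y → two ℚ.* toℚ x ℚ.- toℚ y) Qnat[k-1]≡-1 (Qnat[1+i]≡0 ℕP.≤-refl) ⟩
  (φ (+ 2) -1ℤ ℚ.+ 0ℚ) ℚ.+ 0ℚ     ≡⟨ cong₂ (λ x y → (φ (+ 2) -1ℤ ℚ.+ x) ℚ.+ y) (φ-above (+ 1) (j ℕ.+ 0)) (φ-above (+ 0) (j′ ℕ.+ (k ℕ.+ 0))) ⟨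
  lucasSum 2 -1ℤ                 ∎
  where
  j′ = suc j
  open BackwardRecurrence j′
  open LucasSum j′

lBound≤ : ∀ j m → lBound (suc (suc j)) m ≤ m
lBound≤ zero    m = ℕP.≤-refl
lBound≤ (suc j) m = ℕP.≤-pred (m/n<m (suc m) (suc (suc j)) (s≤s (s≤s z≤n)))

lBound<⇒beyond-diagonal : ∀ j m s {i} → lBound (suc (suc j)) m < i → i ≤ m →
                          suc m < i ℕ.* suc (suc j) ℕ.+ i ℕ.+ s
lBound<⇒beyond-diagonal zero    m s m<i i≤m = contradiction i≤m (ℕP.<⇒≱ m<i)
lBound<⇒beyond-diagonal (suc j) m s {i} l<i _ =
  ℕP.<-≤-trans 1+m<i*n (ℕP.≤-trans (ℕP.*-monoʳ-≤ i (ℕP.n≤1+n n)) (ℕP.≤-trans (ℕP.m≤m+n _ i) (ℕP.m≤m+n _ s)))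
  where
  n = suc (suc j)
  1+m<i*n : suc m < i ℕ.* n
  1+m<i*n = ℕP.≰⇒> (λ i*n≤1+m → ℕP.<⇒≱ l<i (subst (ℕ._≤ suc m ℕ./ n) (m*n/n≡m i n) (/-monoˡ-≤ n i*n≤1+m)))

module LucasIdentity (j : ℕ) where
  open BackwardRecurrence j using (k; Qnat[1+i]≡0)
  open LucasSum j

  q≡lucasSum : ∀ m s → s ≤ suc j → q (suc j ℕ.+ m ℕ.* k ℕ.+ s) ≡ lucasSum (suc m) (+ s ℤ.- 1ℤ)
  q≡lucasSum zero s s≤1+j = begin
    q (suc j ℕ.+ 0 ℕ.+ s)          ≡⟨ cong (λ n → q (n ℕ.+ s)) (ℕP.+-identityʳ (suc j)) ⟩
    q (suc j ℕ.+ s)                ≡⟨ q[k+s-1]≡φ[1,s-1] s s≤1+j ⟩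
    φ (+ 1) (+ s ℤ.- 1ℤ)           ≡⟨ lucasSum-one s ⟨
    lucasSum 1 (+ s ℤ.- 1ℤ)        ∎
  q≡lucasSum (suc zero) zero _ = q[2k-1]≡lucasSum[2,-1] j
  q≡lucasSum (suc (suc m)) zero _ = begin
    q (suc j ℕ.+ suc (suc m) ℕ.* k ℕ.+ 0)
      ≡⟨ cong q (index₁ j m) ⟩
    q (suc n ℕ.+ k)
      ≡⟨ q-rec n ⟩
    two ℚ.* q (suc n) ℚ.- q n
      ≡⟨ cong₂ (λ x y → two ℚ.* x ℚ.- y) (trans (cong q (index₂ j m)) (q≡lucasSum (suc m) zero z≤n))
                                          (q≡lucasSum m (suc j) ℕP.≤-refl) ⟩
    two ℚ.* lucasSum (suc (suc m)) -1ℤ ℚ.- lucasSum (suc m) (+ j)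
      ≡⟨ lucasSum-wrap m ⟨
    lucasSum (suc (suc (suc m))) -1ℤ
      ∎
    where
    n = suc j ℕ.+ m ℕ.* k ℕ.+ suc j
    index₁ : ∀ j m → suc j ℕ.+ suc (suc m) ℕ.* suc (suc j) ℕ.+ 0
                   ≡ suc (suc j ℕ.+ m ℕ.* suc (suc j) ℕ.+ suc j) ℕ.+ suc (suc j)
    index₁ = ℕ-Solver.solve-∀
    index₂ : ∀ j m → suc (suc j ℕ.+ m ℕ.* suc (suc j) ℕ.+ suc j) ≡ suc j ℕ.+ suc m ℕ.* suc (suc j) ℕ.+ 0
    index₂ = ℕ-Solver.solve-∀
  q≡lucasSum (suc m) (suc s) s<1+j = begin
    q (suc j ℕ.+ suc m ℕ.* k ℕ.+ suc s)
      ≡⟨ cong q (index j m s) ⟩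
    q (suc n ℕ.+ k)
      ≡⟨ q-rec n ⟩
    two ℚ.* q (suc n) ℚ.- q n
      ≡⟨ cong₂ (λ x y → two ℚ.* x ℚ.- y) (trans (cong q (sym (ℕP.+-suc (suc j ℕ.+ m ℕ.* k) s))) (q≡lucasSum m (suc s) s<1+j))
                                          (q≡lucasSum m s (ℕP.<⇒≤ s<1+j)) ⟩
    two ℚ.* lucasSum (suc m) (+ s) ℚ.- lucasSum (suc m) (+ s ℤ.- 1ℤ)
      ≡⟨ lucasSum-step m s ⟨
    lucasSum (suc (suc m)) (+ s)
      ∎
    where
    n = suc j ℕ.+ m ℕ.* k ℕ.+ s
    index : ∀ j m s → suc j ℕ.+ suc m ℕ.* suc (suc j) ℕ.+ suc s ≡ suc (suc j ℕ.+ m ℕ.* suc (suc j) ℕ.+ s) ℕ.+ suc (suc j)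
    index = ℕ-Solver.solve-∀

  Q≡lucasSum : ∀ m s → s ≤ suc j → toℚ (Q k (+ (suc m ℕ.* k) ℤ.+ (+ s ℤ.- 1ℤ))) ≡ lucasSum (suc m) (+ s ℤ.- 1ℤ)
  Q≡lucasSum m s s≤1+j = trans (cong (λ n → toℚ (Q k n)) (pos-suc-+-pred (suc j ℕ.+ m ℕ.* k) s)) (q≡lucasSum m s s≤1+j)

  lucasSum≡head : ∀ m s → suc m ≤ j → lucasSum (suc m) (+ s ℤ.- 1ℤ) ≡ φ (+ suc m) (+ s ℤ.- 1ℤ)
  lucasSum≡head m s m<j = begin
    lucasSum (suc m) (+ s ℤ.- 1ℤ)
      ≡⟨ sumTo-truncate (suc m) _ z≤n (λ i 0<i _ → φ-above-ℕ (suc m) i (i ℕ.* k) s (beyond i 0<i)) ⟩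
    φ (+ suc m ℤ.- + 0) (+ 0 ℤ.+ (+ s ℤ.- 1ℤ))
      ≡⟨ cong₂ φ (ℤP.+-identityʳ (+ suc m)) (ℤP.+-identityˡ (+ s ℤ.- 1ℤ)) ⟩
    φ (+ suc m) (+ s ℤ.- 1ℤ)
      ∎
    where
    beyond : ∀ i → 0 < i → suc (suc m) < i ℕ.* k ℕ.+ i ℕ.+ s
    beyond (suc i) _ = ℕP.≤-trans (s≤s (s≤s m<j))
                         (ℕP.≤-trans (ℕP.m≤m+n k (i ℕ.* k)) (ℕP.≤-trans (ℕP.m≤m+n _ (suc i)) (ℕP.m≤m+n _ s)))

  statedSummand : ℕ → ℤ → ℕ → ℚ
  statedSummand m r i =
    sgn (+ (i ℕ.* k) ℤ.+ r) ℚ.*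
      (ψ (+ m ℤ.- + i ℤ.- 1ℤ) (+ (i ℕ.* k) ℤ.+ r ℤ.- 1ℤ) ℚ.* pow2 (+ m ℤ.- + (i ℕ.* (k ℕ.+ 1)) ℤ.- r)
       ℚ.+ ψ (+ m ℤ.- + i ℤ.- 1ℤ) (+ (i ℕ.* k) ℤ.+ r) ℚ.* pow2 (+ m ℤ.- + (i ℕ.* (k ℕ.+ 1)) ℤ.- r ℤ.- + 2))

  statedSummand≡summand : ∀ m r i → statedSummand m r i ≡ summand m r i
  statedSummand≡summand m r i =
    cong (λ e → sgn t ℚ.* (ψ (+ m ℤ.- + i ℤ.- 1ℤ) (t ℤ.- 1ℤ) ℚ.* pow2 e ℚ.+ ψ (+ m ℤ.- + i ℤ.- 1ℤ) t ℚ.* pow2 (e ℤ.- + 2)))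
         exponent
    where
    t = + (i ℕ.* k) ℤ.+ r
    regroup : ∀ m a b r → m ℤ.- (a ℤ.+ b) ℤ.- r ≡ m ℤ.- b ℤ.- (a ℤ.+ r)
    regroup = solve-∀
    exponent : + m ℤ.- + (i ℕ.* (k ℕ.+ 1)) ℤ.- r ≡ + m ℤ.- + i ℤ.- t
    exponent = begin
      + m ℤ.- + (i ℕ.* (k ℕ.+ 1)) ℤ.- r     ≡⟨ cong (λ n → + m ℤ.- + n ℤ.- r) (trans (ℕP.*-distribˡ-+ i k 1) (cong (i ℕ.* k ℕ.+_) (ℕP.*-identityʳ i))) ⟩
      + m ℤ.- + (i ℕ.* k ℕ.+ i) ℤ.- r       ≡⟨ regroup (+ m) (+ (i ℕ.* k)) (+ i) r ⟩
      + m ℤ.- + i ℤ.- t                     ∎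

  m<r⇒Q[mk+r]≡0 : ∀ m r → m < r → r ≤ j → Q k (+ (m ℕ.* k ℕ.+ r)) ≡ 0ℤ
  m<r⇒Q[mk+r]≡0 zero    (suc r) _   r<j = Qnat[1+i]≡0 r<j
  m<r⇒Q[mk+r]≡0 (suc m) r       m<r r≤j = toℚ-injective (begin
    toℚ (Q k (+ (suc m ℕ.* k ℕ.+ r)))   ≡⟨ Q≡lucasSum m (suc r) (s≤s r≤j) ⟩
    lucasSum (suc m) (+ r)              ≡⟨ sumTo-truncate (suc m) _ z≤n (λ i _ _ → vanishes i) ⟩
    summand (suc m) (+ r) 0             ≡⟨ vanishes 0 ⟩
    0ℚ                                  ∎)
    where
    vanishes : ∀ i → summand (suc m) (+ r) i ≡ 0ℚ
    vanishes i = φ-above-ℕ (suc m) i (i ℕ.* k) (suc r) (ℕP.≤-trans (s≤s m<r) (ℕP.m≤n+m (suc r) (i ℕ.* k ℕ.+ i)))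

  Q[mk-1]≡-2^[m-1] : ∀ m → 1 ≤ m → m ≤ j → Q k (+ (m ℕ.* k) ℤ.- 1ℤ) ≡ ℤ.- + (2 ℕ.^ (m ℕ.∸ 1))
  Q[mk-1]≡-2^[m-1] (suc m) _ m<j = toℚ-injective (begin
    toℚ (Q k (+ (suc m ℕ.* k) ℤ.- 1ℤ))   ≡⟨ Q≡lucasSum m 0 z≤n ⟩
    lucasSum (suc m) -1ℤ                ≡⟨ lucasSum≡head m 0 m<j ⟩
    φ (+ suc m) -1ℤ                     ≡⟨ φ-at-minus-one m ⟩
    toℚ (ℤ.- + (2 ℕ.^ m))               ∎)

  Q[mk+r]≡φ : ∀ m r → r ≤ m → m ≤ j → 1 ≤ m → toℚ (Q k (+ (m ℕ.* k ℕ.+ r))) ≡ φ (+ m) (+ r)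
  Q[mk+r]≡φ (suc m) r r≤m m<j _ =
    trans (Q≡lucasSum m (suc r) (s≤s (ℕP.≤-trans r≤m m<j))) (lucasSum≡head m (suc r) m<j)

  Q≡truncatedSum : ∀ m s → s ≤ suc j →
    toℚ (Q k (+ (suc m ℕ.* k) ℤ.+ (+ s ℤ.- 1ℤ))) ≡ sumTo (lBound k (suc m)) (statedSummand (suc m) (+ s ℤ.- 1ℤ))
  Q≡truncatedSum m s s≤1+j = begin
    toℚ (Q k (+ (suc m ℕ.* k) ℤ.+ (+ s ℤ.- 1ℤ)))
      ≡⟨ Q≡lucasSum m s s≤1+j ⟩
    lucasSum (suc m) (+ s ℤ.- 1ℤ)
      ≡⟨ sumTo-truncate (suc m) _ (lBound≤ j (suc m))
           (λ i l<i i≤1+m → φ-above-ℕ (suc m) i (i ℕ.* k) s (lBound<⇒beyond-diagonal j (suc m) s l<i i≤1+m)) ⟩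
    sumTo (lBound k (suc m)) (summand (suc m) (+ s ℤ.- 1ℤ))
      ≡⟨ sumTo-cong (lBound k (suc m)) (λ i _ → statedSummand≡summand (suc m) (+ s ℤ.- 1ℤ) i) ⟨
    sumTo (lBound k (suc m)) (statedSummand (suc m) (+ s ℤ.- 1ℤ))
      ∎

  Q[mk+r]≡sum : ∀ r m → -1ℤ ℤ.≤ r → r ℤ.≤ + j → 1 ≤ m →
                toℚ (Q k (+ (m ℕ.* k) ℤ.+ r)) ≡ sumTo (lBound k m) (statedSummand m r)
  Q[mk+r]≡sum -[1+ zero ]  (suc m) _          _           _ = Q≡truncatedSum m 0 z≤n
  Q[mk+r]≡sum -[1+ suc n ] _       (ℤ.-≤- ()) _           _
  Q[mk+r]≡sum (+ s)        (suc m) _          (ℤ.+≤+ s≤j) _ = Q≡truncatedSum m (suc s) (s≤s s≤j)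

theorem1p2 : (k : ℕ) → 2 ≤ k →
      ((m r : ℕ) → m < r → r ≤ k ℕ.∸ 2 → Q k (+ (m ℕ.* k ℕ.+ r)) ≡ ℤ.0ℤ)
    × ((m : ℕ) → 1 ≤ m → m ≤ k ℕ.∸ 2 →
         Q k (+ (m ℕ.* k) ℤ.- ℤ.1ℤ) ≡ ℤ.- (+ (2 ℕ.^ (m ℕ.∸ 1))))
    × ((m r : ℕ) → r ≤ m → m ≤ k ℕ.∸ 2 → 1 ≤ m →
         toℚ (Q k (+ (m ℕ.* k ℕ.+ r)))
           ≡ sgn (+ r) ℚ.* (ψ (+ m ℤ.- ℤ.1ℤ) (+ r ℤ.- ℤ.1ℤ) ℚ.* pow2 (+ m ℤ.- + r)
                            ℚ.+ ψ (+ m ℤ.- ℤ.1ℤ) (+ r) ℚ.* pow2 (+ m ℤ.- + r ℤ.- + 2)))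
    × ((r : ℤ) (m : ℕ) → ℤ.-1ℤ ℤ.≤ r → r ℤ.≤ + (k ℕ.∸ 2) → 1 ≤ m → k ℕ.∸ 2 ≤ m →
         toℚ (Q k (+ (m ℕ.* k) ℤ.+ r))
           ≡ sumTo (lBound k m) (λ i →
               sgn (+ (i ℕ.* k) ℤ.+ r) ℚ.*
                 (ψ (+ m ℤ.- + i ℤ.- ℤ.1ℤ) (+ (i ℕ.* k) ℤ.+ r ℤ.- ℤ.1ℤ)
                    ℚ.* pow2 (+ m ℤ.- + (i ℕ.* (k ℕ.+ 1)) ℤ.- r)
                  ℚ.+ ψ (+ m ℤ.- + i ℤ.- ℤ.1ℤ) (+ (i ℕ.* k) ℤ.+ r)
                    ℚ.* pow2 (+ m ℤ.- + (i ℕ.* (k ℕ.+ 1)) ℤ.- r ℤ.- + 2))))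
theorem1p2 zero          ()
theorem1p2 (suc zero)    (s≤s ())
theorem1p2 (suc (suc j)) _ =
  m<r⇒Q[mk+r]≡0 , Q[mk-1]≡-2^[m-1] , Q[mk+r]≡φ ,
  -- The identity in (iv) holds for every m ≥ 1.
  λ r m -1≤r r≤k-2 1≤m _ → Q[mk+r]≡sum r m -1≤r r≤k-2 1≤m
  where open LucasIdentity j
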